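{- Let $K_4'$ be the graph with vertex set $\{1,2,3,4,y\}$ whose edges are all six pairs from $\{1,2,3,4\}$ together with the edge $\overline{1y}$ (i.e., the complete graph $K_4$ with a pendant vertex attached to one of its vertices). Then the line graph $L(K_4')$ is non-word-representable.
   Context: All graphs are simple. A word over a finite set $X$ is a finite sequence of elements of $X$. Two letters $a,b$ alternate in a word $w$ if the subsequence of $w$ consisting of all occurrences of $a$ and $b$ is of the form $abab\cdots$ or $baba\cdots$ (of even or odd length). A graph $G=(V,E)$ is word-representable if there exists a word $w$ over $V$ such that for all distinct $a,b\in V$, $\overline{ab}\in E$ if and only if $a$ and $b$ alternate in $w$; otherwise $G$ is non-word-representable. The line graph $L(G)$ of $G$ has vertex set $E$, two vertices being adjacent iff the corresponding edges of $G$ share an endpoint. -}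

module Defs where

open import Data.Nat using (ℕ)
open import Data.Fin using (Fin; zero; suc)
open import Data.Fin.Properties using () renaming (_≟_ to _≟ᶠ_)
open import Data.List using (List; []; _∷_; length; lookup)
open import Data.List.Relation.Unary.All using (All)
open import Data.Product using (_×_; _,_; proj₁; proj₂; Σ; ∃)
open import Data.Sum using (_⊎_)
open import Data.Bool using (Bool; true; false; _∨_)
open import Relation.Nullary using (¬_; Dec; yes; no; does)
open import Relation.Binary.PropositionalEquality using (_≡_; _≢_)
open import Relation.Binary.Definitions using (DecidableEquality)
open import Function.Bundles using (_⇔_)

record Graph : Set₁ where
  field
    V     : Set
    _≟_   : DecidableEquality V
    Adj   : V → V → Set
    sym   : ∀ {a b} → Adj a b → Adj b a
    irr   : ∀ {a} → ¬ Adj a a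

restrict : {V : Set} → DecidableEquality V → V → V → List V → List V
restrict _≟_ a b [] = []
restrict _≟_ a b (x ∷ w) with does (x ≟ a) ∨ does (x ≟ b)
... | true  = x ∷ restrict _≟_ a b w
... | false = restrict _≟_ a b w

-- A word is of the form abab… or baba… (any length) over {a,b} iff no two
-- consecutive letters are equal (all its letters being a or b).
NoRepeat : {V : Set} → List V → Set
NoRepeat []           = Data.Unit.⊤ where import Data.Unit
NoRepeat (x ∷ [])     = Data.Unit.⊤ where import Data.Unit
NoRepeat (x ∷ y ∷ w)  = (x ≢ y) × NoRepeat (y ∷ w)

Alternate : {V : Set} → DecidableEquality V → List V → V → V → Set
Alternate _≟_ w a b = NoRepeat (restrict _≟_ a b w)

WordRepresentable : Graph → Set
WordRepresentable G =
  ∃ λ (w : List V) → ∀ (a b : V) → a ≢ b → (Adj a b ⇔ Alternate _≟_ w a b)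
  where open Graph G

-- Line graph of a graph given by a list of edges (pairs of endpoints, each
-- edge listed exactly once): vertices are the edges (indices into the list),
-- two distinct edges adjacent iff they share an endpoint.
module _ {V : Set} where
  ShareEnd : V × V → V × V → Set
  ShareEnd (u , v) (x , y) = (u ≡ x ⊎ u ≡ y) ⊎ (v ≡ x ⊎ v ≡ y)

LineGraph : {V : Set} → List (V × V) → Graph
LineGraph {V} es = record
  { V   = Fin (length es)
  ; _≟_ = _≟ᶠ_
  ; Adj = λ i j → (i ≢ j) × ShareEnd (lookup es i) (lookup es j)
  ; sym = λ { (i≢j , s) → (λ e → i≢j (Relation.Binary.PropositionalEquality.sym e)) , swapS s }
  ; irr = λ { (i≢i , _) → i≢i Relation.Binary.PropositionalEquality.refl }
  }
  where
  open Data.Sum using (inj₁; inj₂)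
  open Relation.Binary.PropositionalEquality using (sym; refl)
  swapS : ∀ {p q : V × V} → ShareEnd p q → ShareEnd q p
  swapS {u , v} {x , y} (inj₁ (inj₁ e)) = inj₁ (inj₁ (sym e))
  swapS {u , v} {x , y} (inj₁ (inj₂ e)) = inj₂ (inj₁ (sym e))
  swapS {u , v} {x , y} (inj₂ (inj₁ e)) = inj₁ (inj₂ (sym e))
  swapS {u , v} {x , y} (inj₂ (inj₂ e)) = inj₂ (inj₂ (sym e))

data K4'V : Set where
  v1 v2 v3 v4 y : K4'V

K4'edges : List (K4'V × K4'V)
K4'edges =
  (v1 , v2) ∷ (v1 , v3) ∷ (v1 , v4) ∷ (v2 , v3) ∷ (v2 , v4) ∷ (v3 , v4) ∷
  (v1 , y) ∷ []

L-K4' : Graph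
L-K4' = LineGraph K4'edges

{-# OPTIONS --safe #-}
module Submission where

open import Defs
open import Data.Empty using (⊥; ⊥-elim)
open import Data.Unit using (⊤; tt)
open import Data.Bool using (Bool; true; false; T; _∧_; _∨_)
open import Data.Bool.ListAction using (all; any)
open import Data.Bool.Properties using (T-∧; T-∨)
open import Data.Nat using (ℕ; zero; suc)
open import Data.Nat.Properties using (eq?)
open import Data.Fin.Properties using () renaming (_≟_ to _≟ᶠ_)
open import Data.Product using (_×_; _,_; proj₁; proj₂; ∃; swap)
open import Data.Sum using (_⊎_; inj₁; inj₂; [_,_]′)
open import Data.List using (List; []; _∷_; _++_; [_]; map; length; lookup; deduplicate; allFin)
open import Data.List.Properties using (++-assoc; ++-identityʳ)
open import Data.List.Relation.Unary.All using (All; []; _∷_)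
import Data.List.Relation.Unary.All as All
open import Data.List.Relation.Unary.All.Properties using (all-filter; all⁺)
open import Data.List.Relation.Unary.Any using (Any; here; there; any?; satisfied)
open import Data.List.Relation.Unary.Any.Properties using (any⁻)
open import Data.List.Relation.Unary.AllPairs using ([]; _∷_)
open import Data.List.Relation.Unary.Unique.Propositional using (Unique)
open import Data.List.Relation.Unary.Unique.DecPropositional.Properties using (deduplicate-!)
open import Data.List.Relation.Binary.Sublist.Propositional using (_⊆_; []; _∷_; _∷ʳ_; ⊆-trans)
open import Data.List.Relation.Binary.Sublist.Propositional.Properties
  using (All-resp-⊆; Any-resp-⊆; filter-⊆; ++⁺ʳ; []⊆-universal)
open import Data.List.Membership.Propositional using (_∈_; _∉_; find; lose)
open import Data.List.Membership.Propositional.Properties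
  using (∈-++⁺ˡ; ∈-++⁺ʳ; ∈-++⁻; ∈-map⁺; ∈-map⁻; ∈-allFin; ∈-deduplicate⁺)
import Data.List.Membership.DecPropositional as DecMembership
open import Relation.Nullary using (¬_; Dec; yes; no; does; ¬?)
open import Relation.Nullary.Decidable
  using (map′; _×-dec_; _⊎-dec_; isYes; isNo; toWitness; toWitnessFalse)
open import Relation.Unary using (Decidable)
open import Relation.Binary.Definitions using (DecidableEquality)
open import Relation.Binary.PropositionalEquality using (_≡_; _≢_; refl; sym; trans; cong; subst; ≢-sym)
open import Function.Base using (_∘_; _$_)
open import Function.Bundles using (_⇔_; mk⇔; Equivalence; mk↣)
open import Function.Construct.Identity using (⇔-id)
open import Function.Construct.Symmetry using (⇔-sym)
open import Function.Construct.Composition using (_⇔-∘_)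

-- List the vertices in the order of their first occurrences in a representing word.  If
-- a, b, c, d come in this order and ab, bc, cd, ad alternate, then the occurrences of
-- a, b, c, d read abcdabcd…, so ac and bd alternate as well: orienting the edges along
-- this order creates no shortcut on four vertices.  Every vertex may be assumed to occur,
-- since prepending an absent letter changes no alternation.  An exhaustive search over
-- the 7! orders of the vertices of L(K₄′) finds such a shortcut in each of them.

unique-⊆ : ∀ {A : Set} {xs ys : List A} → xs ⊆ ys → Unique ys → Unique xs
unique-⊆ []             []       = []
unique-⊆ (_ ∷ʳ xs⊆ys)   (_ ∷ u)  = unique-⊆ xs⊆ys u
unique-⊆ (refl ∷ xs⊆ys) (x∉ ∷ u) = All-resp-⊆ xs⊆ys x∉ ∷ unique-⊆ xs⊆ys u

unique-++-∉ : ∀ {A : Set} {y : A} xs {ys} → Unique (xs ++ y ∷ ys) → y ∉ xs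
unique-++-∉ (x ∷ xs) (x≢ ∷ _) (here refl) = All.lookup x≢ (∈-++⁺ʳ xs (here refl)) refl
unique-++-∉ (x ∷ xs) (_ ∷ u)  (there y∈)  = unique-++-∉ xs u y∈

combinations : ∀ {A : Set} → ℕ → List A → List (List A)
combinations zero    _        = [ [] ]
combinations (suc k) []       = []
combinations (suc k) (x ∷ xs) = map (x ∷_) (combinations k xs) ++ combinations (suc k) xs

∈-combinations⁻ : ∀ {A : Set} {ys : List A} k xs → ys ∈ combinations k xs → ys ⊆ xs
∈-combinations⁻ zero    xs       (here refl) = []⊆-universal xs
∈-combinations⁻ (suc k) (x ∷ xs) ys∈ with ∈-++⁻ (map (x ∷_) (combinations k xs)) ys∈
... | inj₁ ys∈map with ∈-map⁻ (x ∷_) ys∈map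
...   | zs , zs∈ , refl = refl ∷ ∈-combinations⁻ k xs zs∈
∈-combinations⁻ (suc k) (x ∷ xs) ys∈ | inj₂ ys∈rest = x ∷ʳ ∈-combinations⁻ (suc k) xs ys∈rest

∈-combinations⁺ : ∀ {A : Set} {ys xs : List A} → ys ⊆ xs → ys ∈ combinations (length ys) xs
∈-combinations⁺ {ys = []}    _            = here refl
∈-combinations⁺ {ys = _ ∷ _} (_ ∷ʳ ys⊆)   = ∈-++⁺ʳ _ (∈-combinations⁺ ys⊆)
∈-combinations⁺ {ys = _ ∷ _} (refl ∷ ys⊆) = ∈-++⁺ˡ (∈-map⁺ _ (∈-combinations⁺ ys⊆))

module Alternation {V : Set} (_≟_ : DecidableEquality V) where

  AltFrom : V → V → List V → Set
  AltFrom a b []      = ⊤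
  AltFrom a b (z ∷ w) with z ≟ a | z ≟ b
  ... | yes _ | _     = AltFrom b a w
  ... | no _  | yes _ = ⊥
  ... | no _  | no _  = AltFrom a b w

  restrict-comm : ∀ a b w → restrict _≟_ a b w ≡ restrict _≟_ b a w
  restrict-comm a b []      = refl
  restrict-comm a b (z ∷ w) with z ≟ a | z ≟ b
  ... | yes _ | yes _ = cong (z ∷_) (restrict-comm a b w)
  ... | yes _ | no _  = cong (z ∷_) (restrict-comm a b w)
  ... | no _  | yes _ = cong (z ∷_) (restrict-comm a b w)
  ... | no _  | no _  = restrict-comm a b w

  restrict-⊆ : ∀ a b w → restrict _≟_ a b w ⊆ w
  restrict-⊆ a b []      = []
  restrict-⊆ a b (z ∷ w) with does (z ≟ a) ∨ does (z ≟ b)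
  ... | true  = refl ∷ restrict-⊆ a b w
  ... | false = z ∷ʳ restrict-⊆ a b w

  noRepeat-tail : ∀ {x : V} r → NoRepeat (x ∷ r) → NoRepeat r
  noRepeat-tail []      _       = tt
  noRepeat-tail (_ ∷ _) (_ , r) = r

  noRepeat-∷-fresh : ∀ {x : V} r → x ∉ r → NoRepeat (x ∷ r) ⇔ NoRepeat r
  noRepeat-∷-fresh []      _   = mk⇔ _ _
  noRepeat-∷-fresh (_ ∷ _) x∉r = mk⇔ proj₂ ((x∉r ∘ here) ,_)

  altFrom⇔noRepeat : ∀ {a b} w → a ≢ b → AltFrom a b w ⇔ NoRepeat (b ∷ restrict _≟_ a b w)
  altFrom⇔noRepeat []      _   = mk⇔ _ _
  altFrom⇔noRepeat {a} {b} (z ∷ w) a≢b with z ≟ a | z ≟ b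
  ... | yes refl | _        rewrite restrict-comm a b w =
    mk⇔ (λ alt → ≢-sym a≢b , Equivalence.to swapped alt) (Equivalence.from swapped ∘ proj₂)
    where
    swapped : AltFrom b a w ⇔ NoRepeat (a ∷ restrict _≟_ b a w)
    swapped = altFrom⇔noRepeat w (≢-sym a≢b)
  ... | no _     | yes refl = mk⇔ ⊥-elim (λ (b≢b , _) → b≢b refl)
  ... | no _     | no _     = altFrom⇔noRepeat w a≢b

  altFrom⇒alternate : ∀ {a b} w → a ≢ b → AltFrom a b w → Alternate _≟_ w a b
  altFrom⇒alternate w a≢b = noRepeat-tail _ ∘ Equivalence.to (altFrom⇔noRepeat w a≢b)

  alternate⇒altFrom : ∀ {a b} w → a ∷ b ∷ [] ⊆ deduplicate _≟_ w →
                      Alternate _≟_ w a b → AltFrom a b w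
  alternate⇒altFrom {a} {b} (z ∷ w) (.z ∷ʳ ab⊆) alt
    with z ≟ a | z ≟ b | All-resp-⊆ ab⊆ (all-filter (¬? ∘ (z ≟_)) (deduplicate _≟_ w))
  ... | yes z≡a | _       | z≢a ∷ _      = ⊥-elim (z≢a z≡a)
  ... | no _    | yes z≡b | _ ∷ z≢b ∷ [] = ⊥-elim (z≢b z≡b)
  ... | no _    | no _    | _            =
    alternate⇒altFrom w (⊆-trans ab⊆ (filter-⊆ _ (deduplicate _≟_ w))) alt
  alternate⇒altFrom {a} {b} (a ∷ w) (refl ∷ b⊆) alt
    with a ≟ a | a ≟ b | All-resp-⊆ b⊆ (all-filter (¬? ∘ (a ≟_)) (deduplicate _≟_ w))
  ... | no a≢a | _ | _        = ⊥-elim (a≢a refl)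
  ... | yes _  | _ | a≢b ∷ [] rewrite restrict-comm a b w =
    Equivalence.from (altFrom⇔noRepeat w (≢-sym a≢b)) alt

  -- The first of the letters a, b, c, d in w can only be a, and after it the hypotheses
  -- hold for the rotated cycle b c d a: the four letters occur in w as abcdabcd…
  altFrom-cycle : ∀ {a b c d} w → Unique (a ∷ b ∷ c ∷ d ∷ []) →
                  AltFrom a b w → AltFrom b c w → AltFrom c d w → AltFrom a d w →
                  AltFrom a c w × AltFrom b d w
  altFrom-cycle []      _ _ _ _ _ = tt , tt
  altFrom-cycle {a} {b} {c} {d} (z ∷ w)
    u@((a≢b ∷ a≢c ∷ a≢d ∷ []) ∷ (b≢c ∷ b≢d ∷ []) ∷ (c≢d ∷ []) ∷ [] ∷ []) ab bc cd ad
    with z ≟ a | z ≟ b | z ≟ c | z ≟ d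
  ... | yes refl | yes a≡b | _       | _       = ⊥-elim (a≢b a≡b)
  ... | yes refl | no _    | yes a≡c | _       = ⊥-elim (a≢c a≡c)
  ... | yes refl | no _    | no _    | yes a≡d = ⊥-elim (a≢d a≡d)
  ... | yes refl | no _    | no _    | no _    = swap (altFrom-cycle w rotated bc cd ad ab)
    where
    rotated : Unique (b ∷ c ∷ d ∷ a ∷ [])
    rotated = (b≢c ∷ b≢d ∷ ≢-sym a≢b ∷ []) ∷ (c≢d ∷ ≢-sym a≢c ∷ []) ∷ (≢-sym a≢d ∷ []) ∷ [] ∷ []
  ... | no _     | yes refl | _        | _        = ⊥-elim ab
  ... | no _     | no _     | yes refl | _        = ⊥-elim bc
  ... | no _     | no _     | no _     | yes refl = ⊥-elim cd
  ... | no _     | no _     | no _     | no _     = altFrom-cycle w u ab bc cd ad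

  alternate-∷-fresh : ∀ {x} a b w → x ∉ w → Alternate _≟_ (x ∷ w) a b ⇔ Alternate _≟_ w a b
  alternate-∷-fresh {x} a b w x∉w with does (x ≟ a) ∨ does (x ≟ b)
  ... | true  = noRepeat-∷-fresh _ (x∉w ∘ Any-resp-⊆ (restrict-⊆ a b w))
  ... | false = ⇔-id _

module _ (G : Graph) where
  open Graph G
  open Alternation _≟_
  open DecMembership _≟_ using (_∈?_)

  Represents : List V → Set
  Represents w = ∀ a b → a ≢ b → (Adj a b ⇔ Alternate _≟_ w a b)

  represents-∷-fresh : ∀ {x w} → x ∉ w → Represents w → Represents (x ∷ w)
  represents-∷-fresh {w = w} x∉w rep a b a≢b =
    ⇔-sym (alternate-∷-fresh a b w x∉w) ⇔-∘ rep a b a≢b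

  representation-covering : ∀ {w} (vs : List V) → Represents w →
                            ∃ λ w′ → Represents w′ × (∀ {v} → v ∈ vs → v ∈ w′)
  representation-covering {w} [] rep = w , rep , λ ()
  representation-covering {w} (x ∷ vs) rep with representation-covering {w} vs rep
  ... | w′ , rep′ , covers with x ∈? w′
  ...   | yes x∈w′ = w′ , rep′ , λ { (here refl) → x∈w′ ; (there v∈) → covers v∈ }
  ...   | no  x∉w′ = x ∷ w′ , represents-∷-fresh x∉w′ rep′ ,
                     λ { (here refl) → here refl ; (there v∈) → there (covers v∈) }

  -- Orienting every edge from the earlier to the later vertex of a list containing
  -- a, b, c, d in this order, the four vertices form a shortcut in the sense of
  -- semi-transitive orientations.
  data IsShortcut : List V → Set where
    shortcut : ∀ {a b c d} → Adj a b → Adj b c → Adj c d → Adj a d →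
               ¬ Adj a c ⊎ ¬ Adj b d → IsShortcut (a ∷ b ∷ c ∷ d ∷ [])

  HasShortcut : List V → Set
  HasShortcut order = ∃ λ path → path ⊆ order × IsShortcut path

  hasShortcut-++ : ∀ {order} rest → HasShortcut order → HasShortcut (order ++ rest)
  hasShortcut-++ rest (path , path⊆ , s) = path , ++⁺ʳ rest path⊆ , s

  adj⇒≢ : ∀ {a b} → Adj a b → a ≢ b
  adj⇒≢ adj refl = irr adj

  firstOccurrences-chords : ∀ {w a b c d} → Represents w → Unique (a ∷ b ∷ c ∷ d ∷ []) →
                            a ∷ b ∷ c ∷ d ∷ [] ⊆ deduplicate _≟_ w →
                            Adj a b → Adj b c → Adj c d → Adj a d → Adj a c × Adj b d
  firstOccurrences-chords {w} {a} {b} {c} {d} rep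
    distinct@((_ ∷ a≢c ∷ _ ∷ []) ∷ (_ ∷ b≢d ∷ []) ∷ _) ordered ab bc cd ad =
    adjacent a≢c (proj₁ chords) , adjacent b≢d (proj₂ chords)
    where
    altFrom : ∀ {x y} → x ∷ y ∷ [] ⊆ a ∷ b ∷ c ∷ d ∷ [] → Adj x y → AltFrom x y w
    altFrom sub adj =
      alternate⇒altFrom w (⊆-trans sub ordered) (Equivalence.to (rep _ _ (adj⇒≢ adj)) adj)
    adjacent : ∀ {x y} → x ≢ y → AltFrom x y w → Adj x y
    adjacent x≢y alt = Equivalence.from (rep _ _ x≢y) (altFrom⇒alternate w x≢y alt)
    chords : AltFrom a c w × AltFrom b d w
    chords = altFrom-cycle w distinct
      (altFrom (refl ∷ refl ∷ c ∷ʳ d ∷ʳ []) ab) (altFrom (a ∷ʳ refl ∷ refl ∷ d ∷ʳ []) bc)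
      (altFrom (a ∷ʳ b ∷ʳ refl ∷ refl ∷ []) cd) (altFrom (refl ∷ b ∷ʳ c ∷ʳ refl ∷ []) ad)

  firstOccurrences-noShortcut : ∀ {w} → Represents w → ¬ HasShortcut (deduplicate _≟_ w)
  firstOccurrences-noShortcut {w} rep (_ , ordered , shortcut ab bc cd ad missing)
    with firstOccurrences-chords rep (unique-⊆ ordered (deduplicate-! _≟_ w)) ordered ab bc cd ad
  ... | ac , bd = [ _$ ac , _$ bd ]′ missing

  module _ (adj? : ∀ a b → Dec (Adj a b)) where

    isShortcut? : Decidable IsShortcut
    isShortcut? (a ∷ b ∷ c ∷ d ∷ []) =
      map′ (λ (ab , bc , cd , ad , missing) → shortcut ab bc cd ad missing)
           (λ { (shortcut ab bc cd ad missing) → ab , bc , cd , ad , missing })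
           (adj? a b ×-dec adj? b c ×-dec adj? c d ×-dec adj? a d ×-dec
            (¬? (adj? a c) ⊎-dec ¬? (adj? b d)))
    isShortcut? []                      = no λ ()
    isShortcut? (_ ∷ [])                = no λ ()
    isShortcut? (_ ∷ _ ∷ [])            = no λ ()
    isShortcut? (_ ∷ _ ∷ _ ∷ [])        = no λ ()
    isShortcut? (_ ∷ _ ∷ _ ∷ _ ∷ _ ∷ _) = no λ ()

    hasShortcut? : Decidable HasShortcut
    hasShortcut? order = map′ fromAny toAny (any? isShortcut? (combinations 4 order))
      where
      fromAny : Any IsShortcut (combinations 4 order) → HasShortcut order
      fromAny s with find s
      ... | path , path∈ , isShortcut = path , ∈-combinations⁻ 4 order path∈ , isShortcut
      toAny : HasShortcut order → Any IsShortcut (combinations 4 order)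
      toAny (path , path⊆ , isShortcut@(shortcut _ _ _ _ _)) = lose (∈-combinations⁺ path⊆) isShortcut

module CompletionSearch {V : Set} (_≟_ : DecidableEquality V) (vs : List V)
                        {P : List V → Set} (P? : Decidable P) where
  open DecMembership _≟_ using (_∈?_)

  -- A listing that already contains every letter must satisfy P itself, hence the
  -- test for an unused letter.
  allCompletions : ℕ → List V → Bool
  allCompletions zero    acc = isYes (P? acc)
  allCompletions (suc n) acc =
    isYes (P? acc) ∨
    (any (λ v → isNo (v ∈? acc)) vs ∧
     all (λ v → isYes (v ∈? acc) ∨ allCompletions n (acc ++ [ v ])) vs)

  allCompletions-sound : (∀ {xs} ys → P xs → P (xs ++ ys)) → (∀ v → v ∈ vs) →
                         ∀ n acc rest → T (allCompletions n acc) →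
                         Unique (acc ++ rest) → (∀ v → v ∈ acc ++ rest) → P (acc ++ rest)
  allCompletions-sound P-++ enum zero acc rest t _ _ = P-++ rest (toWitness t)
  allCompletions-sound P-++ enum (suc n) acc rest t u covers
    with Equivalence.to (T-∨ {isYes (P? acc)}) t
  ... | inj₁ p = P-++ rest (toWitness p)
  allCompletions-sound P-++ enum (suc n) acc [] t u covers | inj₂ t′
    with satisfied (any⁻ _ vs (proj₁ (Equivalence.to T-∧ t′)))
  ... | v , v∉acc = ⊥-elim (toWitnessFalse v∉acc (subst (v ∈_) (++-identityʳ acc) (covers v)))
  allCompletions-sound P-++ enum (suc n) acc (v ∷ rest) t u covers | inj₂ t′
    with Equivalence.to (T-∨ {isYes (v ∈? acc)})
           (All.lookup (all⁺ _ vs (proj₂ (Equivalence.to T-∧ t′))) (enum v))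
  ... | inj₁ v∈acc = ⊥-elim (unique-++-∉ acc u (toWitness v∈acc))
  ... | inj₂ done  =
    subst P (++-assoc acc [ v ] rest)
      (allCompletions-sound P-++ enum n (acc ++ [ v ]) rest done
        (subst Unique (sym (++-assoc acc [ v ] rest)) u)
        (subst (λ xs → ∀ x → x ∈ xs) (sym (++-assoc acc [ v ] rest)) covers))

lineGraph-adj? : ∀ {V : Set} → DecidableEquality V → (es : List (V × V)) →
                 ∀ i j → Dec (Graph.Adj (LineGraph es) i j)
lineGraph-adj? {V} _≟_ es i j = ¬? (i ≟ᶠ j) ×-dec shareEnd? (lookup es i) (lookup es j)
  where
  shareEnd? : (e f : V × V) → Dec (ShareEnd e f)
  shareEnd? (u , v) (u′ , v′) = ((u ≟ u′) ⊎-dec (u ≟ v′)) ⊎-dec ((v ≟ u′) ⊎-dec (v ≟ v′))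

vertexIndex : K4'V → ℕ
vertexIndex v1 = 0
vertexIndex v2 = 1
vertexIndex v3 = 2
vertexIndex v4 = 3
vertexIndex y  = 4

vertexAt : ℕ → K4'V
vertexAt 0 = v1
vertexAt 1 = v2
vertexAt 2 = v3
vertexAt 3 = v4
vertexAt _ = y

vertexAt-vertexIndex : ∀ v → vertexAt (vertexIndex v) ≡ v
vertexAt-vertexIndex v1 = refl
vertexAt-vertexIndex v2 = refl
vertexAt-vertexIndex v3 = refl
vertexAt-vertexIndex v4 = refl
vertexAt-vertexIndex y  = refl

_≟ᵛ_ : DecidableEquality K4'V
_≟ᵛ_ = eq? (mk↣ λ {u} {v} eq →
  trans (sym (vertexAt-vertexIndex u)) (trans (cong vertexAt eq) (vertexAt-vertexIndex v)))

L-K4'-everyOrder-hasShortcut : ∀ order → Unique order → (∀ v → v ∈ order) → HasShortcut L-K4' order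
L-K4'-everyOrder-hasShortcut order unique covers =
  allCompletions-sound (hasShortcut-++ L-K4') ∈-allFin 7 [] order _ unique covers
  where open CompletionSearch _≟ᶠ_ (allFin 7) (hasShortcut? L-K4' (lineGraph-adj? _≟ᵛ_ K4'edges))

lemma1 : ¬ WordRepresentable L-K4'
lemma1 (w , rep) with representation-covering L-K4' {w} (allFin 7) rep
... | w′ , rep′ , covers =
  firstOccurrences-noShortcut L-K4' rep′
    (L-K4'-everyOrder-hasShortcut (deduplicate _≟ᶠ_ w′) (deduplicate-! _≟ᶠ_ w′)
      λ v → ∈-deduplicate⁺ _≟ᶠ_ (covers (∈-allFin v)))
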